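{- Let $G=(V,E)$ be a connected unweighted graph with capacities $L:V\to\mathbb{Z}_{\ge0}$ and integers $k>\alpha\ge0$, and let $\Gamma$, $\{C_v\}_{v\in\Gamma}$, $B$, $G'$ be as described in the context. If $\mathit{ILP}_{k,\alpha}(G)$ is feasible, then $\mathit{LP}_{k,\alpha}(G,\{C_v\}_{v\in\Gamma})$ is feasible.
   Context: $d=d_G$ is the shortest-path metric; $N_G(U)=\{w: d(w,u)\le1\text{ for some }u\in U\}$ (closed neighbourhood). $\Gamma\subseteq V$ and the partition $\{C_v\}_{v\in\Gamma}$ of $V$ satisfy: there is a rooted tree on $\Gamma$ with $d_G(u,v)=3$ for every tree edge $(u,v)$; $N_G(v)\subseteq C_v$ for every $v\in\Gamma$; and $d_G(u,v)\le2$ for every $v\in\Gamma$ and $u\in C_v$. For each $v\in\Gamma$, $B_v\subseteq C_v$ is a set of $\alpha$ elements of $C_v$ with largest capacities, and $B=\bigcup_{v\in\Gamma}B_v$. $G'=(V,E')$ is the directed graph whose arcs are the pairs $(u,w)$ such that $\{u,w\}\in E$, or there exist $v\in\Gamma$ and $t\in N_G(v)$ with $\{u,t\}\in E$ and $w\in B_v$; $N_{G'}(U)$ denotes $U$ together with all out-neighbours in $G'$ of vertices of $U$. $\mathit{ILP}_{k,\alpha}(G)$ is the system in variables $y_u$, $u\in V$: $\sum_{u\in V}y_u=k$; $|U|\le\sum_{u\in N_G(U)\setminus F}y_uL_u$ for all $U\subseteq V$ and $F\subseteq V$ with $|F|=\alpha$; $y_u\in\{0,1\}$. $\mathit{LP}_{k,\alpha}(G,\{C_v\}_{v\in\Gamma})$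 is the system: $\sum_{u\in V}y_u=k$; $|U|\le\sum_{u\in N_{G'}(U)\setminus F}y_uL_u$ for all $U\subseteq V$ and $F\subseteq B$ with $|F|=\alpha$; $1\le\sum_{u\in N_G(v)\setminus B}y_u$ for all $v\in\Gamma$; $y_u=1$ for all $u\in B$; $0\le y_u\le1$ for all $u\in V$. -}

module Defs where

open import Data.Nat as ℕ using (ℕ; zero; suc; _≤_; _<_; _+_; _*_)
open import Data.Integer using (+_)
open import Data.Rational as ℚ using (ℚ; 0ℚ; 1ℚ)
open import Data.Bool using (Bool; true; false; T; _∧_; _∨_; not; if_then_else_)
open import Data.Fin using (Fin; zero; suc; _≟_)
open import Data.Fin.Subset using (Subset; _∈_; _∉_; _∩_; ∣_∣)
open import Data.Vec using (lookup; tabulate)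
open import Data.Product using (Σ; _×_; ∃; ∃-syntax; _,_)
open import Relation.Nullary using (¬_; does)
open import Relation.Binary.PropositionalEquality using (_≡_; _≢_)

record Graph (n : ℕ) : Set where
  field
    adj    : Fin n → Fin n → Bool
    sym    : ∀ u w → adj u w ≡ adj w u
    irrefl : ∀ u → adj u u ≡ false
open Graph public

data Walk {n : ℕ} (G : Graph n) : Fin n → Fin n → ℕ → Set where
  here : ∀ {u} → Walk G u u 0
  step : ∀ {u w v ℓ} → T (adj G u w) → Walk G w v ℓ → Walk G u v (suc ℓ)

DistLe : ∀ {n} → Graph n → Fin n → Fin n → ℕ → Set
DistLe G u v m = ∃[ ℓ ] (ℓ ≤ m × Walk G u v ℓ)

Dist3 : ∀ {n} → Graph n → Fin n → Fin n → Set
Dist3 G u v = DistLe G u v 3 × ¬ DistLe G u v 2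

Connected : ∀ {n} → Graph n → Set
Connected {n} G = ∀ (u v : Fin n) → ∃[ m ] DistLe G u v m

_==_ : ∀ {n} → Fin n → Fin n → Bool
u == w = does (u ≟ w)

anyV : ∀ {n} → (Fin n → Bool) → Bool
anyV {zero}  f = false
anyV {suc n} f = f zero ∨ anyV (λ i → f (suc i))

∑ℕ : ∀ {n} → (Fin n → ℕ) → ℕ
∑ℕ {zero}  f = 0
∑ℕ {suc n} f = f zero + ∑ℕ (λ i → f (suc i))

∑ℚ : ∀ {n} → (Fin n → ℚ) → ℚ
∑ℚ {zero}  f = 0ℚ
∑ℚ {suc n} f = f zero ℚ.+ ∑ℚ (λ i → f (suc i))

toℚ : ℕ → ℚ
toℚ m = + m ℚ./ 1

nbrᵇ : ∀ {n} → Graph n → Fin n → Fin n → Bool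
nbrᵇ G u w = (w == u) ∨ adj G w u

NG : ∀ {n} → Graph n → Subset n → Subset n
NG G U = tabulate (λ w → anyV (λ u → lookup U u ∧ nbrᵇ G u w))

-- Clusters.  The partition {C_v}_{v∈Γ} of V is given by an assignment
-- c : V → V with c u ∈ Γ; C_v = { u : c u = v }.

Cl : ∀ {n} → (Fin n → Fin n) → Fin n → Subset n
Cl c v = tabulate (λ u → c u == v)

-- There is a rooted tree on Γ whose edges (v, parent v) all have d_G = 3.
-- (Tree given by a root r ∈ Γ and a parent map on Γ ∖ {r}; acyclicity is
--  witnessed by a depth function strictly decreasing along parent edges.)
RootedTree3 : ∀ {n} → Graph n → Subset n → Set
RootedTree3 {n} G Γ =
  Σ (Fin n) λ r → r ∈ Γ ×
  Σ (Fin n → Fin n) λ par → Σ (Fin n → ℕ) λ depth →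
    ∀ v → v ∈ Γ → v ≢ r →
      par v ∈ Γ × Dist3 G v (par v) × depth (par v) < depth v

ClusterPartition : ∀ {n} → Graph n → Subset n → (Fin n → Fin n) → Set
ClusterPartition {n} G Γ c =
  (∀ u → c u ∈ Γ) ×
  (∀ v → v ∈ Γ → ∀ w → DistLe G w v 1 → c w ≡ v) ×
  (∀ u → DistLe G u (c u) 2)

-- B_v = B ∩ C_v is a set of α elements of C_v with largest capacities,
-- for every v ∈ Γ  (B = ⋃_v B_v, since the C_v partition V).
TopCapacity : ∀ {n} → (Fin n → ℕ) → ℕ → Subset n → (Fin n → Fin n) → Subset n → Set
TopCapacity {n} L α Γ c B =
  (∀ v → v ∈ Γ → ∣ B ∩ Cl c v ∣ ≡ α) ×
  (∀ v → v ∈ Γ → ∀ u w → u ∈ B ∩ Cl c v → w ∈ Cl c v → w ∉ B → L w ≤ L u)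

arc' : ∀ {n} → Graph n → Subset n → (Fin n → Fin n) → Subset n → Fin n → Fin n → Bool
arc' G Γ c B u w =
  adj G u w ∨
  anyV (λ v → lookup Γ v ∧ anyV (λ t → nbrᵇ G v t ∧ adj G u t)
                          ∧ lookup B w ∧ (c w == v))

NG' : ∀ {n} → Graph n → Subset n → (Fin n → Fin n) → Subset n → Subset n → Subset n
NG' G Γ c B U = tabulate (λ w → anyV (λ u → lookup U u ∧ ((u == w) ∨ arc' G Γ c B u w)))

ILPFeasible : ∀ {n} → Graph n → (Fin n → ℕ) → ℕ → ℕ → Set
ILPFeasible {n} G L k α =
  Σ (Fin n → ℕ) λ y →
    (∀ u → y u ≤ 1) ×
    ∑ℕ y ≡ k ×
    (∀ (U F : Subset n) → ∣ F ∣ ≡ α →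
       ∣ U ∣ ≤ ∑ℕ (λ u → if lookup (NG G U) u ∧ not (lookup F u)
                           then y u * L u else 0))

LPFeasible : ∀ {n} → Graph n → (Fin n → ℕ) → ℕ → ℕ →
             Subset n → (Fin n → Fin n) → Subset n → Set
LPFeasible {n} G L k α Γ c B =
  Σ (Fin n → ℚ) λ y →
    ∑ℚ y ≡ toℚ k ×
    (∀ (U F : Subset n) → (∀ u → u ∈ F → u ∈ B) → ∣ F ∣ ≡ α →
       toℚ ∣ U ∣ ℚ.≤ ∑ℚ (λ u → if lookup (NG' G Γ c B U) u ∧ not (lookup F u)
                                 then y u ℚ.* toℚ (L u) else 0ℚ)) ×
    (∀ v → v ∈ Γ →
       1ℚ ℚ.≤ ∑ℚ (λ u → if lookup (NG G (tabulate (λ x → x == v))) u ∧ not (lookup B u)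
                          then y u else 0ℚ)) ×
    (∀ u → u ∈ B → y u ≡ 1ℚ) ×
    (∀ u → 0ℚ ℚ.≤ y u × y u ℚ.≤ 1ℚ)

module Submission where

-- An integral solution z of ILP_{k,α}(G) satisfies an invariant stronger than LP_{k,α}: |z| = k, the
-- covering constraints hold in G′ for every F with |F| = α (not only F ⊆ B), and every v ∈ Γ has more
-- opened vertices in N_G(v) ∖ B than closed vertices in B_v (otherwise, as |B_v| = α, some F of size α
-- would contain every opened vertex of N_G(v), violating the ILP constraint for U = {v}).
-- While some b ∈ B_v is closed, open it and close an opened r ∈ N_G(v) ∖ B instead: L r ≤ L b since B_v
-- holds the largest capacities of C_v, and every G′-neighbourhood containing r contains b (arcs of G′
-- into B_v), so the covering constraints survive; the reserve and the deficit of v both drop by one.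
-- Once B is open, z itself is a solution of the LP.

open import Defs hiding (sym)
open import Data.Bool using (Bool; true; false; T; _∧_; _∨_; not; if_then_else_)
open import Data.Bool.Properties using (∧-comm; ∧-identityʳ; T-≡; T-not-≡; T-∧; T-∨)
open import Data.Empty using (⊥-elim)
open import Data.Fin using (Fin; zero; suc; _≟_)
import Data.Fin.Properties as Fin
open import Data.Fin.Subset using (Subset; _∈_; _∉_; _∩_; ∣_∣)
import Data.Integer as ℤ
import Data.Integer.Properties as ℤ
open import Data.Nat using (ℕ; zero; suc; _+_; _*_; _≤_; _<_; _≡ᵇ_; z≤n; s≤s; _≤?_)
open import Data.Nat.Properties hiding (_≟_)
open import Algebra.Properties.CommutativeSemigroup +-commutativeSemigroup
  using (interchange; xy∙z≈zy∙x; xy∙z≈xz∙y; xy∙z≈x∙zy)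
open import Data.Nat.Coprimality using (1-coprimeTo)
import Data.Nat.Coprimality as Coprime
open import Data.Product using (∃-syntax; _×_; _,_; proj₁; proj₂; map)
open import Data.Rational using (ℚ; mkℚ; 0ℚ; 1ℚ)
import Data.Rational as ℚ
import Data.Rational.Properties as ℚ
open import Data.Sum using (inj₁; inj₂)
open import Data.Vec using ([]; _∷_; lookup; tabulate)
open import Data.Vec.Properties using (lookup∘tabulate; lookup-zipWith; []=⇒lookup; lookup⇒[]=)
import Data.Vec.Functional as Vector
open import Data.Vec.Functional.Properties using (updateAt-updates; updateAt-minimal)
open import Function using (_∘_; id; Equivalence)
open import Relation.Nullary using (¬_; yes; no)
open import Relation.Nullary.Decidable using (dec-true)
open import Relation.Binary.PropositionalEquality

open Equivalence using (to; from)

toℚ-canonical : ∀ m → toℚ m ≡ mkℚ (ℤ.+ m) 0 (Coprime.sym (1-coprimeTo m))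
toℚ-canonical m = ℚ.normalize-coprime (Coprime.sym (1-coprimeTo m))

toℚ-+ : ∀ a b → toℚ (a + b) ≡ toℚ a ℚ.+ toℚ b
toℚ-+ a b = begin
  toℚ (a + b)                                   ≡⟨ cong (ℚ._/ 1) (ℤ.pos-+ a b) ⟩
  (ℤ.+ a ℤ.+ ℤ.+ b) ℚ./ 1                       ≡⟨ cong₂ (λ x y → (x ℤ.+ y) ℚ./ 1)
                                                     (sym (ℤ.*-identityʳ (ℤ.+ a))) (sym (ℤ.*-identityʳ (ℤ.+ b))) ⟩
  (ℤ.+ a ℤ.* ℤ.+ 1 ℤ.+ ℤ.+ b ℤ.* ℤ.+ 1) ℚ./ 1  ≡⟨ sym (cong₂ ℚ._+_ (toℚ-canonical a) (toℚ-canonical b)) ⟩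
  toℚ a ℚ.+ toℚ b                               ∎
  where open ≡-Reasoning

toℚ-* : ∀ a b → toℚ (a * b) ≡ toℚ a ℚ.* toℚ b
toℚ-* a b = trans (cong (ℚ._/ 1) (ℤ.pos-* a b))
                  (sym (cong₂ ℚ._*_ (toℚ-canonical a) (toℚ-canonical b)))

toℚ-mono-≤ : ∀ {a b} → a ≤ b → toℚ a ℚ.≤ toℚ b
toℚ-mono-≤ {a} {b} a≤b rewrite toℚ-canonical a | toℚ-canonical b =
  ℚ.*≤* (ℤ.*-monoʳ-≤-nonNeg (ℤ.+ 1) (ℤ.+≤+ a≤b))

∑ℚ-cong : ∀ {n} {f g : Fin n → ℚ} → (∀ u → f u ≡ g u) → ∑ℚ f ≡ ∑ℚ g
∑ℚ-cong {zero}  f≗g = refl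
∑ℚ-cong {suc n} f≗g = cong₂ ℚ._+_ (f≗g zero) (∑ℚ-cong (f≗g ∘ suc))

∑ℚ-toℚ : ∀ {n} (f : Fin n → ℕ) → ∑ℚ (toℚ ∘ f) ≡ toℚ (∑ℕ f)
∑ℚ-toℚ {zero}  f = refl
∑ℚ-toℚ {suc n} f = trans (cong (toℚ (f zero) ℚ.+_) (∑ℚ-toℚ (f ∘ suc))) (sym (toℚ-+ (f zero) _))

⟦_⟧ : Bool → ℕ
⟦ true  ⟧ = 1
⟦ false ⟧ = 0

⟦⟧≤1 : ∀ b → ⟦ b ⟧ ≤ 1
⟦⟧≤1 true  = ≤-refl
⟦⟧≤1 false = z≤n

⟦⟧-mono : ∀ {a b} → (T a → T b) → ⟦ a ⟧ ≤ ⟦ b ⟧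
⟦⟧-mono {false}         _   = z≤n
⟦⟧-mono {true}  {true}  _   = ≤-refl
⟦⟧-mono {true}  {false} a⇒b = ⊥-elim (a⇒b _)

⟦⟧-cong : ∀ {a b} → (T a → T b) → (T b → T a) → ⟦ a ⟧ ≡ ⟦ b ⟧
⟦⟧-cong a⇒b b⇒a = ≤-antisym (⟦⟧-mono a⇒b) (⟦⟧-mono b⇒a)

⟦⟧-false : ∀ {a} → ¬ T a → ⟦ a ⟧ ≡ 0
⟦⟧-false {true}  ¬a = ⊥-elim (¬a _)
⟦⟧-false {false} _  = refl

⟦∨⟧+⟦∧⟧ : ∀ x y → ⟦ x ∨ y ⟧ + ⟦ x ∧ y ⟧ ≡ ⟦ x ⟧ + ⟦ y ⟧
⟦∨⟧+⟦∧⟧ true  true  = refl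
⟦∨⟧+⟦∧⟧ true  false = refl
⟦∨⟧+⟦∧⟧ false true  = refl
⟦∨⟧+⟦∧⟧ false false = refl

⟦∨⟧≤ : ∀ x y → ⟦ x ∨ y ⟧ ≤ ⟦ x ⟧ + ⟦ y ⟧
⟦∨⟧≤ x y = m+n≤o⇒m≤o ⟦ x ∨ y ⟧ (≤-reflexive (⟦∨⟧+⟦∧⟧ x y))

⟦⟧-split : ∀ z x → ⟦ x ⟧ ≡ ⟦ z ∧ x ⟧ + ⟦ not z ∧ x ⟧
⟦⟧-split true  x = sym (+-identityʳ ⟦ x ⟧)
⟦⟧-split false x = refl

⟦≡ᵇ1⟧ : ∀ m → m ≤ 1 → ⟦ m ≡ᵇ 1 ⟧ ≡ m
⟦≡ᵇ1⟧ 0             _        = refl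
⟦≡ᵇ1⟧ 1             _        = refl
⟦≡ᵇ1⟧ (suc (suc m)) (s≤s ())

if-⟦⟧ : ∀ x z l → (if x then ⟦ z ⟧ * l else 0) ≡ ⟦ z ∧ x ⟧ * l
if-⟦⟧ true  z     l = cong (λ b → ⟦ b ⟧ * l) (sym (∧-identityʳ z))
if-⟦⟧ false true  l = refl
if-⟦⟧ false false l = refl

if-toℚ-* : ∀ x z l → (if x then toℚ ⟦ z ⟧ ℚ.* toℚ l else 0ℚ) ≡ toℚ (⟦ z ∧ x ⟧ * l)
if-toℚ-* true  z l = trans (sym (toℚ-* ⟦ z ⟧ l)) (cong toℚ (if-⟦⟧ true z l))
if-toℚ-* false z l = cong toℚ (if-⟦⟧ false z l)

if-toℚ : ∀ x z → (if x then toℚ ⟦ z ⟧ else 0ℚ) ≡ toℚ ⟦ z ∧ x ⟧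
if-toℚ true  z     = cong (toℚ ∘ ⟦_⟧) (sym (∧-identityʳ z))
if-toℚ false true  = refl
if-toℚ false false = refl

T-∧-map : ∀ {a a′ b b′} → (T a → T a′) → (T b → T b′) → T (a ∧ b) → T (a′ ∧ b′)
T-∧-map f g = from T-∧ ∘ map f g ∘ to T-∧

T-not⇒¬T : ∀ {x} → T (not x) → ¬ T x
T-not⇒¬T {false} _ ()

==-refl : ∀ {n} (u : Fin n) → T (u == u)
==-refl u = from T-≡ (dec-true (u ≟ u) refl)

≡⇒== : ∀ {n} {u v : Fin n} → u ≡ v → T (u == v)
≡⇒== {u = u} refl = ==-refl u

==⇒≡ : ∀ {n} {u v : Fin n} → T (u == v) → u ≡ v
==⇒≡ {u = u} {v} t with u ≟ v
... | yes u≡v = u≡v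

∈⇒T : ∀ {n} {S : Subset n} {u} → u ∈ S → T (lookup S u)
∈⇒T u∈S = from T-≡ ([]=⇒lookup u∈S)

anyV⁺ : ∀ {n} {f : Fin n → Bool} u → T (f u) → T (anyV f)
anyV⁺ zero    t = from T-∨ (inj₁ t)
anyV⁺ (suc u) t = from T-∨ (inj₂ (anyV⁺ u t))

anyV⁻ : ∀ {n} {f : Fin n → Bool} → T (anyV f) → ∃[ u ] T (f u)
anyV⁻ {suc n} t with to T-∨ t
... | inj₁ t₀ = zero , t₀
... | inj₂ t′ with anyV⁻ t′
...   | u , tu = suc u , tu

∑-cong : ∀ {n} {f g : Fin n → ℕ} → (∀ u → f u ≡ g u) → ∑ℕ f ≡ ∑ℕ g
∑-cong {zero}  f≗g = refl
∑-cong {suc n} f≗g = cong₂ _+_ (f≗g zero) (∑-cong (f≗g ∘ suc))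

∑-mono-≤ : ∀ {n} {f g : Fin n → ℕ} → (∀ u → f u ≤ g u) → ∑ℕ f ≤ ∑ℕ g
∑-mono-≤ {zero}  f≤g = z≤n
∑-mono-≤ {suc n} f≤g = +-mono-≤ (f≤g zero) (∑-mono-≤ (f≤g ∘ suc))

∑-distrib-+ : ∀ {n} (f g : Fin n → ℕ) → ∑ℕ (λ u → f u + g u) ≡ ∑ℕ f + ∑ℕ g
∑-distrib-+ {zero}  f g = refl
∑-distrib-+ {suc n} f g = trans (cong (f zero + g zero +_) (∑-distrib-+ (f ∘ suc) (g ∘ suc)))
                                (interchange (f zero) (g zero) _ _)

∑-zero : ∀ {n} → ∑ℕ {n} (λ _ → 0) ≡ 0
∑-zero {zero}  = refl
∑-zero {suc n} = ∑-zero {n}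

≤-∑ : ∀ {n} (f : Fin n → ℕ) u → f u ≤ ∑ℕ f
≤-∑ f zero    = m≤m+n (f zero) _
≤-∑ f (suc u) = ≤-trans (≤-∑ (f ∘ suc) u) (m≤n+m _ (f zero))

Agree : ∀ {n} {A : Set} → Fin n → Fin n → (Fin n → A) → (Fin n → A) → Set
Agree r b f g = ∀ u → u ≢ r → u ≢ b → f u ≡ g u

Agree-map : ∀ {n} {A C : Set} {r b : Fin n} {f g : Fin n → A} (h : Fin n → A → C) →
            Agree r b f g → Agree r b (λ u → h u (f u)) (λ u → h u (g u))
Agree-map h f≈g u u≢r u≢b = cong (h u) (f≈g u u≢r u≢b)

∑-agree-but : ∀ {n} {f g : Fin n → ℕ} p → (∀ u → u ≢ p → f u ≡ g u) → ∑ℕ f + g p ≡ ∑ℕ g + f p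
∑-agree-but {suc n} {f} {g} zero f≈g = begin
  f zero + ∑ℕ (f ∘ suc) + g zero  ≡⟨ cong (λ s → f zero + s + g zero) (∑-cong (λ u → f≈g (suc u) λ ())) ⟩
  f zero + ∑ℕ (g ∘ suc) + g zero  ≡⟨ xy∙z≈zy∙x (f zero) _ (g zero) ⟩
  g zero + ∑ℕ (g ∘ suc) + f zero  ∎
  where open ≡-Reasoning
∑-agree-but {suc n} {f} {g} (suc p) f≈g = begin
  f zero + ∑ℕ (f ∘ suc) + g (suc p)    ≡⟨ +-assoc (f zero) _ _ ⟩
  f zero + (∑ℕ (f ∘ suc) + g (suc p))  ≡⟨ cong₂ _+_ (f≈g zero λ ())
                                           (∑-agree-but p (λ u u≢p → f≈g (suc u) (u≢p ∘ Fin.suc-injective))) ⟩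
  g zero + (∑ℕ (g ∘ suc) + f (suc p))  ≡⟨ sym (+-assoc (g zero) _ _) ⟩
  g zero + ∑ℕ (g ∘ suc) + f (suc p)    ∎
  where open ≡-Reasoning

∑-exchange : ∀ {n} {f g : Fin n → ℕ} {r b} → r ≢ b → Agree r b f g →
             ∑ℕ f + (g r + g b) ≡ ∑ℕ g + (f r + f b)
∑-exchange {n} {f} {g} {r} {b} r≢b f≈g = begin
  ∑ℕ f + (g r + g b)  ≡⟨ sym (+-assoc (∑ℕ f) (g r) (g b)) ⟩
  ∑ℕ f + g r + g b    ≡⟨ cong (λ x → ∑ℕ f + x + g b) (sym hr) ⟩
  ∑ℕ f + h r + g b    ≡⟨ cong (_+ g b) (sym (∑-agree-but r h≈f)) ⟩
  ∑ℕ h + f r + g b    ≡⟨ xy∙z≈xz∙y (∑ℕ h) (f r) (g b) ⟩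
  ∑ℕ h + g b + f r    ≡⟨ cong (_+ f r) (∑-agree-but b h≈g) ⟩
  ∑ℕ g + h b + f r    ≡⟨ cong (λ x → ∑ℕ g + x + f r) hb ⟩
  ∑ℕ g + f b + f r    ≡⟨ xy∙z≈x∙zy (∑ℕ g) (f b) (f r) ⟩
  ∑ℕ g + (f r + f b)  ∎
  where
  open ≡-Reasoning
  h : Fin n → ℕ
  h = Vector.updateAt f r (λ _ → g r)
  hr : h r ≡ g r
  hr = updateAt-updates r f
  hb : h b ≡ f b
  hb = updateAt-minimal b r f (r≢b ∘ sym)
  h≈f : ∀ u → u ≢ r → h u ≡ f u
  h≈f u u≢r = updateAt-minimal u r f u≢r
  h≈g : ∀ u → u ≢ b → h u ≡ g u
  h≈g u u≢b with u ≟ r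
  ... | yes refl = hr
  ... | no u≢r   = trans (h≈f u u≢r) (f≈g u u≢r u≢b)

∑-exchange-+ : ∀ {n} {f g : Fin n → ℕ} {r b} d → r ≢ b → Agree r b f g →
               f r + f b + d ≡ g r + g b → ∑ℕ f + d ≡ ∑ℕ g
∑-exchange-+ {f = f} {g} {r} {b} d r≢b f≈g local = +-cancelʳ-≡ (f r + f b) _ _ (begin
  ∑ℕ f + d + (f r + f b)  ≡⟨ xy∙z≈x∙zy (∑ℕ f) d _ ⟩
  ∑ℕ f + (f r + f b + d)  ≡⟨ cong (∑ℕ f +_) local ⟩
  ∑ℕ f + (g r + g b)      ≡⟨ ∑-exchange r≢b f≈g ⟩
  ∑ℕ g + (f r + f b)      ∎)
  where open ≡-Reasoning

∑-exchange-≤ : ∀ {n} {f g : Fin n → ℕ} {r b} → r ≢ b → Agree r b f g →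
               f r + f b ≤ g r + g b → ∑ℕ f ≤ ∑ℕ g
∑-exchange-≤ {f = f} {g} {r} {b} r≢b f≈g local = +-cancelʳ-≤ (f r + f b) _ _ (begin
  ∑ℕ f + (f r + f b)  ≤⟨ +-monoʳ-≤ (∑ℕ f) local ⟩
  ∑ℕ f + (g r + g b)  ≡⟨ ∑-exchange r≢b f≈g ⟩
  ∑ℕ g + (f r + f b)  ∎)
  where open ≤-Reasoning

update₂ : ∀ {n} {A : Set} → (Fin n → A) → Fin n → A → Fin n → A → Fin n → A
update₂ f r x b y = Vector.updateAt (Vector.updateAt f r (λ _ → x)) b (λ _ → y)

module _ {n} {A : Set} (f : Fin n → A) (r : Fin n) (x : A) (b : Fin n) (y : A) where

  update₂-at-r : r ≢ b → update₂ f r x b y r ≡ x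
  update₂-at-r r≢b = trans (updateAt-minimal r b _ r≢b) (updateAt-updates r f)

  update₂-at-b : update₂ f r x b y b ≡ y
  update₂-at-b = updateAt-updates b _

  update₂-agree : Agree r b (update₂ f r x b y) f
  update₂-agree u u≢r u≢b = trans (updateAt-minimal u b _ u≢b) (updateAt-minimal u r f u≢r)

count : ∀ {n} → (Fin n → Bool) → ℕ
count p = ∑ℕ (⟦_⟧ ∘ p)

count≤n : ∀ {n} (p : Fin n → Bool) → count p ≤ n
count≤n {zero}  p = z≤n
count≤n {suc n} p = +-mono-≤ (⟦⟧≤1 (p zero)) (count≤n (p ∘ suc))

count-pos : ∀ {n} (p : Fin n → Bool) → 0 < count p → ∃[ u ] T (p u)
count-pos {suc n} p pos with p zero in p₀
... | true  = zero , from T-≡ p₀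
... | false with count-pos (p ∘ suc) pos
...   | u , tu = suc u , tu

T⇒count-pos : ∀ {n} (p : Fin n → Bool) u → T (p u) → 0 < count p
T⇒count-pos p u t = ≤-trans (⟦⟧-mono {true} (λ _ → t)) (≤-∑ (⟦_⟧ ∘ p) u)

count-== : ∀ {n} (v : Fin n) → count (_== v) ≡ 1
count-== {suc n} zero    = cong suc (∑-zero {n})
count-== {suc n} (suc v) = count-== v

∣∣≡count : ∀ {n} (S : Subset n) → ∣ S ∣ ≡ count (lookup S)
∣∣≡count []          = refl
∣∣≡count (true  ∷ S) = cong suc (∣∣≡count S)
∣∣≡count (false ∷ S) = ∣∣≡count S

∣tabulate∣≡count : ∀ {n} (p : Fin n → Bool) → ∣ tabulate p ∣ ≡ count p
∣tabulate∣≡count p = trans (∣∣≡count (tabulate p)) (∑-cong (cong ⟦_⟧ ∘ lookup∘tabulate p))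

extend-∷ : ∀ {n} {a : Fin (suc n) → Bool} {m m′} x → (T (a zero) → T x) → ⟦ x ⟧ + m ≡ m′ →
           ∃[ f ] (∀ u → T (a (suc u)) → T (f u)) × count f ≡ m →
           ∃[ f ] (∀ u → T (a u) → T (f u)) × count f ≡ m′
extend-∷ x a₀⇒x eq (f , a⊆f , cf) =
  x Vector.∷ f , (λ { zero → a₀⇒x ; (suc u) → a⊆f u }) , trans (cong (⟦ x ⟧ +_) cf) eq

extend-to-count : ∀ {n} (a : Fin n → Bool) m → count a ≤ m → m ≤ n →
                  ∃[ f ] (∀ u → T (a u) → T (f u)) × count f ≡ m
extend-to-count {zero}  a zero _ _ = (λ ()) , (λ ()) , refl
extend-to-count {suc n} a m ca≤m m≤1+n with a zero in a₀ | m ≤? n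
extend-to-count {suc n} a zero    ()           _         | true  | _
extend-to-count {suc n} a (suc m) (s≤s ca≤m) (s≤s m≤n) | true  | _ =
  extend-∷ true _ refl (extend-to-count (a ∘ suc) m ca≤m m≤n)
extend-to-count {suc n} a m       ca≤m         m≤1+n     | false | yes m≤n =
  extend-∷ false (subst T a₀) refl (extend-to-count (a ∘ suc) m ca≤m m≤n)
extend-to-count {suc n} a m       ca≤m         m≤1+n     | false | no m≰n =
  extend-∷ true _ (≤-antisym (≰⇒> m≰n) m≤1+n) (extend-to-count (a ∘ suc) n (count≤n (a ∘ suc)) ≤-refl)

walk⇒adj : ∀ {n} {G : Graph n} {u w ℓ} → Walk G u w ℓ → u ≢ w → ∃[ t ] T (adj G u t)
walk⇒adj here       u≢u = ⊥-elim (u≢u refl)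
walk⇒adj (step a _) _   = _ , a

module Neighbourhoods {n} (G : Graph n) (Γ : Subset n) (c : Fin n → Fin n) (B : Subset n) where

  N[_] : Fin n → Fin n → Bool
  N[ v ] = lookup (NG G (tabulate (_== v)))

  N′ : Subset n → Fin n → Bool
  N′ U = lookup (NG' G Γ c B U)

  NG⁻ : ∀ U w → T (lookup (NG G U) w) → ∃[ u ] T (lookup U u) × T (nbrᵇ G u w)
  NG⁻ U w t with anyV⁻ (subst T (lookup∘tabulate _ w) t)
  ... | u , tu = u , to T-∧ tu

  N′⁻ : ∀ U w → T (N′ U w) → ∃[ u ] T (lookup U u) × T ((u == w) ∨ arc' G Γ c B u w)
  N′⁻ U w t with anyV⁻ (subst T (lookup∘tabulate _ w) t)
  ... | u , tu = u , to T-∧ tu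

  N′⁺ : ∀ U u w → T (lookup U u) → T ((u == w) ∨ arc' G Γ c B u w) → T (N′ U w)
  N′⁺ U u w tu t = subst T (sym (lookup∘tabulate _ w)) (anyV⁺ u (from T-∧ (tu , t)))

  N[]⇒nbrᵇ : ∀ {v u} → T (N[ v ] u) → T (nbrᵇ G v u)
  N[]⇒nbrᵇ {v} {u} t with NG⁻ (tabulate (_== v)) u t
  ... | x , x=v , nbr with ==⇒≡ {u = x} {v} (subst T (lookup∘tabulate (_== v) x) x=v)
  ...   | refl = nbr

  N[]⇒dist≤1 : ∀ {v u} → T (N[ v ] u) → DistLe G u v 1
  N[]⇒dist≤1 {v} {u} t with to T-∨ (N[]⇒nbrᵇ t)
  ... | inj₂ a = 1 , ≤-refl , step a here
  ... | inj₁ u=v with ==⇒≡ {u = u} {v} u=v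
  ...   | refl = 0 , z≤n , here

  NG⊆N′ : ∀ U w → T (lookup (NG G U) w) → T (N′ U w)
  NG⊆N′ U w t with NG⁻ U w t
  ... | u , tu , nbr with to T-∨ nbr
  ...   | inj₂ a = N′⁺ U u w tu (from (T-∨ {u == w}) (inj₂ (from (T-∨ {adj G u w}) (inj₁ (subst T (Graph.sym G w u) a)))))
  ...   | inj₁ w=u with ==⇒≡ {u = w} {u} w=u
  ...     | refl = N′⁺ U u w tu (from (T-∨ {w == w}) (inj₁ (==-refl w)))

  arc′-into-B : ∀ {u w} v t → T (lookup Γ v) → T (nbrᵇ G v t) → T (adj G u t) →
                T (lookup B w) → T (c w == v) → T (arc' G Γ c B u w)
  arc′-into-B {u} {w} v t v∈Γ vt ut w∈B cw = from (T-∨ {adj G u w}) (inj₂ (anyV⁺ v through-v))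
    where
    some-t : T (anyV (λ t′ → nbrᵇ G v t′ ∧ adj G u t′))
    some-t = anyV⁺ t (from (T-∧ {nbrᵇ G v t}) (vt , ut))
    through-v : T (lookup Γ v ∧ anyV (λ t′ → nbrᵇ G v t′ ∧ adj G u t′) ∧ lookup B w ∧ (c w == v))
    through-v = from (T-∧ {lookup Γ v}) (v∈Γ , from T-∧ (some-t , from (T-∧ {lookup B w}) (w∈B , cw)))

  arc′-outside-B : ∀ {u w} → lookup B w ≡ false → T (arc' G Γ c B u w) → T (adj G u w)
  arc′-outside-B {u} {w} w∉B t with to (T-∨ {adj G u w}) t
  ... | inj₁ uw = uw
  ... | inj₂ via-B with anyV⁻ {n} via-B
  ...   | v , tv = ⊥-elim (subst T w∉B (proj₁ (to (T-∧ {lookup B w}) (proj₂ (to (T-∧ {anyV {n} _}) (proj₂ (to (T-∧ {lookup Γ v}) tv)))))))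

  adj-within-nbrᵇ : Connected G → ∀ {v r b} → T (nbrᵇ G v r) → r ≢ b →
                    ∃[ t ] T (nbrᵇ G v t) × T (adj G r t)
  adj-within-nbrᵇ conn {v} {r} {b} vr r≢b with to T-∨ vr
  ... | inj₂ rv = v , from (T-∨ {v == v}) (inj₁ (==-refl v)) , rv
  ... | inj₁ r=v with ==⇒≡ {u = r} {v} r=v | walk⇒adj (proj₂ (proj₂ (proj₂ (conn r b)))) r≢b
  ...   | refl | t , rt = t , from (T-∨ {t == r}) (inj₂ (subst T (Graph.sym G r t) rt)) , rt

  N′-transfer : Connected G → ∀ U {v r b} → T (lookup Γ v) → T (N[ v ] r) → lookup B r ≡ false →
                T (lookup B b) → T (c b == v) → r ≢ b → T (N′ U r) → T (N′ U b)
  N′-transfer conn U {v} {r} {b} v∈Γ r∈N r∉B b∈B cb r≢b t with N′⁻ U r t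
  ... | u , tu , u→r = N′⁺ U u b tu (from (T-∨ {u == b}) (inj₂ (arc′-into-B v (proj₁ witness) v∈Γ vt ut b∈B cb)))
    where
    witness : ∃[ t ] T (nbrᵇ G v t) × T (adj G u t)
    witness with to T-∨ u→r
    ... | inj₂ arc = r , N[]⇒nbrᵇ r∈N , arc′-outside-B r∉B arc
    ... | inj₁ u=r with ==⇒≡ {u = u} {r} u=r
    ...   | refl = adj-within-nbrᵇ conn (N[]⇒nbrᵇ r∈N) r≢b
    vt = proj₁ (proj₂ witness)
    ut = proj₂ (proj₂ witness)

module FromILP {n} (G : Graph n) (conn : Connected G) (L : Fin n → ℕ) (k α : ℕ)
               (Γ : Subset n) (c : Fin n → Fin n) (B : Subset n)
               (CP : ClusterPartition G Γ c) (TC : TopCapacity L α Γ c B) where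

  open Neighbourhoods G Γ c B

  inB : Fin n → Bool
  inB = lookup B

  c∈Γ : ∀ u → c u ∈ Γ
  c∈Γ = proj₁ CP

  N[]⊆C : ∀ {v u} → v ∈ Γ → T (N[ v ] u) → c u ≡ v
  N[]⊆C v∈Γ t = proj₁ (proj₂ CP) _ v∈Γ _ (N[]⇒dist≤1 t)

  lookup-B∩C : ∀ v u → lookup (B ∩ Cl c v) u ≡ inB u ∧ (c u == v)
  lookup-B∩C v u = trans (lookup-zipWith _∧_ u B (Cl c v)) (cong (inB u ∧_) (lookup∘tabulate _ u))

  usable : (Fin n → Bool) → Subset n → Subset n → Fin n → Bool
  usable z U F u = z u ∧ (N′ U u ∧ not (lookup F u))

  NG-usable : ∀ z U F u → T (z u ∧ (lookup (NG G U) u ∧ not (lookup F u))) → T (usable z U F u)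
  NG-usable z U F u = T-∧-map {z u} id (T-∧-map {lookup (NG G U) u} (NG⊆N′ U u) id)

  capacity : (Fin n → Bool) → Subset n → Subset n → ℕ
  capacity z U F = ∑ℕ (λ u → ⟦ usable z U F u ⟧ * L u)

  spare deficit kept : (Fin n → Bool) → Fin n → Fin n → Bool
  spare   z v u = z u ∧ (not (inB u) ∧ N[ v ] u)
  deficit z v u = not (z u) ∧ (inB u ∧ (c u == v))
  kept    z v u = z u ∧ (inB u ∧ (c u == v))

  missing : (Fin n → Bool) → Fin n → Bool
  missing z u = not (z u) ∧ inB u

  kept+deficit : ∀ z {v} → v ∈ Γ → count (kept z v) + count (deficit z v) ≡ α
  kept+deficit z {v} v∈Γ = begin
    count (kept z v) + count (deficit z v)            ≡⟨ sym (∑-distrib-+ (⟦_⟧ ∘ kept z v) (⟦_⟧ ∘ deficit z v)) ⟩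
    ∑ℕ (λ u → ⟦ kept z v u ⟧ + ⟦ deficit z v u ⟧)    ≡⟨ sym (∑-cong (λ u → ⟦⟧-split (z u) _)) ⟩
    count (λ u → inB u ∧ (c u == v))                  ≡⟨ sym (∑-cong (cong ⟦_⟧ ∘ lookup-B∩C v)) ⟩
    count (lookup (B ∩ Cl c v))                       ≡⟨ sym (∣∣≡count (B ∩ Cl c v)) ⟩
    ∣ B ∩ Cl c v ∣                                     ≡⟨ proj₁ TC v v∈Γ ⟩
    α                                                 ∎
    where open ≡-Reasoning

  record Invariant (z : Fin n → Bool) : Set where
    field
      size    : count z ≡ k
      covers  : ∀ U F → ∣ F ∣ ≡ α → ∣ U ∣ ≤ capacity z U F
      reserve : ∀ v → v ∈ Γ → count (deficit z v) < count (spare z v)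

  invariant+B-open⇒LP : ∀ {z} → Invariant z → count (missing z) ≡ 0 → LPFeasible G L k α Γ c B
  invariant+B-open⇒LP {z} I nothing-missing =
      y
    , trans (∑ℚ-toℚ (⟦_⟧ ∘ z)) (cong toℚ size)
    , (λ U F _ ∣F∣≡α → subst (toℚ ∣ U ∣ ℚ.≤_) (sym (capacity-toℚ U F)) (toℚ-mono-≤ (covers U F ∣F∣≡α)))
    , (λ v v∈Γ → subst (1ℚ ℚ.≤_) (sym (spare-toℚ v)) (toℚ-mono-≤ (≤-trans (s≤s z≤n) (reserve v v∈Γ))))
    , B⊆z
    , (λ u → toℚ-mono-≤ (z≤n {⟦ z u ⟧}) , toℚ-mono-≤ (⟦⟧≤1 (z u)))
    where
    open Invariant I
    y : Fin n → ℚ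
    y u = toℚ ⟦ z u ⟧
    capacity-toℚ : ∀ U F →
      ∑ℚ (λ u → if N′ U u ∧ not (lookup F u) then y u ℚ.* toℚ (L u) else 0ℚ) ≡ toℚ (capacity z U F)
    capacity-toℚ U F = trans (∑ℚ-cong (λ u → if-toℚ-* (N′ U u ∧ not (lookup F u)) (z u) (L u)))
                             (∑ℚ-toℚ (λ u → ⟦ usable z U F u ⟧ * L u))
    spare-toℚ : ∀ v → ∑ℚ (λ u → if N[ v ] u ∧ not (inB u) then y u else 0ℚ) ≡ toℚ (count (spare z v))
    spare-toℚ v = trans (∑ℚ-cong λ u → trans (if-toℚ (N[ v ] u ∧ not (inB u)) (z u))
                                             (cong (λ x → toℚ ⟦ z u ∧ x ⟧) (∧-comm (N[ v ] u) _)))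
                        (∑ℚ-toℚ (⟦_⟧ ∘ spare z v))
    B⊆z : ∀ u → u ∈ B → y u ≡ 1ℚ
    B⊆z u u∈B with z u in zu
    ... | true  = refl
    ... | false = ⊥-elim (n≮0 (subst (0 <_) nothing-missing
                    (T⇒count-pos (missing z) u (from (T-∧ {not (z u)}) (from T-not-≡ zu , ∈⇒T u∈B)))))

  exchange-capacity-≤ : ∀ a a′ x y {l l′} → l ≤ l′ → (T a → T a′) →
                        ⟦ a ∧ not (x ∨ y) ⟧ * l + 0 ≤ ⟦ a′ ∧ not y ⟧ * l′
  exchange-capacity-≤ false _     _     _     _    _    = z≤n
  exchange-capacity-≤ true  _     true  _     _    _    = z≤n
  exchange-capacity-≤ true  _     false true  _    _    = z≤n
  exchange-capacity-≤ true  false false false _    a⇒a′ = ⊥-elim (a⇒a′ _)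
  exchange-capacity-≤ true  true  false false {l} {l′} l≤l′ _
    rewrite +-identityʳ l | +-identityʳ l | +-identityʳ l′ = l≤l′

  module Exchange {z : Fin n → Bool} (I : Invariant z) {v r b : Fin n} (v∈Γ : v ∈ Γ)
                  (r∈N : T (N[ v ] r)) (r∉B : inB r ≡ false) (zr : z r ≡ true)
                  (b∈B : inB b ≡ true) (cb : c b ≡ v) (zb : z b ≡ false) where

    open Invariant I

    r≢b : r ≢ b
    r≢b r≡b with trans (sym r∉B) (trans (cong inB r≡b) b∈B)
    ... | ()

    z′ : Fin n → Bool
    z′ = update₂ z r false b true

    z′r : z′ r ≡ false
    z′r = update₂-at-r z r false b true r≢b

    z′b : z′ b ≡ true
    z′b = update₂-at-b z r false b true

    z′≈z : Agree r b z′ z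
    z′≈z = update₂-agree z r false b true

    size′ : count z′ ≡ k
    size′ = trans (sym (+-identityʳ (count z′)))
                  (trans (∑-exchange-+ 0 r≢b (Agree-map (λ _ → ⟦_⟧) z′≈z) local) size)
      where
      local : ⟦ z′ r ⟧ + ⟦ z′ b ⟧ + 0 ≡ ⟦ z r ⟧ + ⟦ z b ⟧
      local rewrite z′r | z′b | zr | zb = refl

    missing′ : suc (count (missing z′)) ≡ count (missing z)
    missing′ = trans (+-comm 1 _) (∑-exchange-+ 1 r≢b (Agree-map (λ u x → ⟦ not x ∧ inB u ⟧) z′≈z) local)
      where
      local : ⟦ missing z′ r ⟧ + ⟦ missing z′ b ⟧ + 1 ≡ ⟦ missing z r ⟧ + ⟦ missing z b ⟧
      local rewrite z′r | z′b | zr | zb | r∉B | b∈B = refl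

    N[]r≡cb : ∀ {w} → w ∈ Γ → ⟦ N[ w ] r ⟧ ≡ ⟦ c b == w ⟧
    N[]r≡cb {w} w∈Γ = ⟦⟧-cong
      (λ r∈Nw → ≡⇒== (trans cb (trans (sym (N[]⊆C v∈Γ r∈N)) (N[]⊆C w∈Γ r∈Nw))))
      (λ cb=w → subst (λ x → T (N[ x ] r)) (trans (sym cb) (==⇒≡ {u = c b} {w} cb=w)) r∈N)

    reserve′ : ∀ w → w ∈ Γ → count (deficit z′ w) < count (spare z′ w)
    reserve′ w w∈Γ = +-cancelʳ-≤ δ _ _ (begin
      suc (count (deficit z′ w)) + δ  ≡⟨ cong suc deficit-drop ⟩
      suc (count (deficit z w))       ≤⟨ reserve w w∈Γ ⟩
      count (spare z w)               ≡⟨ sym spare-drop ⟩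
      count (spare z′ w) + δ          ∎)
      where
      open ≤-Reasoning
      δ : ℕ
      δ = ⟦ c b == w ⟧
      deficit-drop : count (deficit z′ w) + δ ≡ count (deficit z w)
      deficit-drop = ∑-exchange-+ δ r≢b (Agree-map (λ u x → ⟦ not x ∧ (inB u ∧ (c u == w)) ⟧) z′≈z) local
        where
        local : ⟦ deficit z′ w r ⟧ + ⟦ deficit z′ w b ⟧ + δ ≡ ⟦ deficit z w r ⟧ + ⟦ deficit z w b ⟧
        local rewrite z′r | z′b | zr | zb | r∉B | b∈B = refl
      spare-drop : count (spare z′ w) + δ ≡ count (spare z w)
      spare-drop = trans (cong (count (spare z′ w) +_) (sym (N[]r≡cb w∈Γ)))
        (∑-exchange-+ ⟦ N[ w ] r ⟧ r≢b (Agree-map (λ u x → ⟦ x ∧ (not (inB u) ∧ N[ w ] u) ⟧) z′≈z) local)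
        where
        local : ⟦ spare z′ w r ⟧ + ⟦ spare z′ w b ⟧ + ⟦ N[ w ] r ⟧ ≡ ⟦ spare z w r ⟧ + ⟦ spare z w b ⟧
        local rewrite z′r | z′b | zr | zb | r∉B | b∈B = sym (+-identityʳ ⟦ N[ w ] r ⟧)

    L-r≤L-b : L r ≤ L b
    L-r≤L-b = proj₂ TC v v∈Γ b r b∈B∩C r∈C r∉B′
      where
      b∈B∩C : b ∈ B ∩ Cl c v
      b∈B∩C = lookup⇒[]= b (B ∩ Cl c v) (trans (lookup-B∩C v b) (cong₂ _∧_ b∈B (to T-≡ (≡⇒== cb))))
      r∈C : r ∈ Cl c v
      r∈C = lookup⇒[]= r (Cl c v) (trans (lookup∘tabulate _ r) (to T-≡ (≡⇒== (N[]⊆C v∈Γ r∈N))))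
      r∉B′ : r ∉ B
      r∉B′ r∈B with trans (sym r∉B) ([]=⇒lookup r∈B)
      ... | ()

    -- shift F excludes r as soon as F excludes r or b, and excludes b only if F excludes both:
    -- closing r then costs z′ nothing that opening b does not recover.
    shift : Subset n → Fin n → Bool
    shift F = update₂ (lookup F) r (lookup F r ∨ lookup F b) b (lookup F r ∧ lookup F b)

    ∣shift∣ : ∀ F → ∣ tabulate (shift F) ∣ ≡ ∣ F ∣
    ∣shift∣ F = begin
      ∣ tabulate (shift F) ∣  ≡⟨ ∣tabulate∣≡count (shift F) ⟩
      count (shift F)        ≡⟨ sym (+-identityʳ _) ⟩
      count (shift F) + 0    ≡⟨ ∑-exchange-+ 0 r≢b (Agree-map (λ _ → ⟦_⟧) (update₂-agree (lookup F) r _ b _)) local ⟩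
      count (lookup F)       ≡⟨ sym (∣∣≡count F) ⟩
      ∣ F ∣                  ∎
      where
      open ≡-Reasoning
      fr = lookup F r
      fb = lookup F b
      local : ⟦ shift F r ⟧ + ⟦ shift F b ⟧ + 0 ≡ ⟦ fr ⟧ + ⟦ fb ⟧
      local rewrite update₂-at-r (lookup F) r (fr ∨ fb) b (fr ∧ fb) r≢b
                  | update₂-at-b (lookup F) r (fr ∨ fb) b (fr ∧ fb)
        = trans (+-identityʳ _) (⟦∨⟧+⟦∧⟧ fr fb)

    capacity-shift-≤ : ∀ U F → capacity z U (tabulate (shift F)) ≤ capacity z′ U F
    capacity-shift-≤ U F = ∑-exchange-≤ r≢b agree local
      where
      fr = lookup F r
      fb = lookup F b
      F* = tabulate (shift F)
      agree : Agree r b (λ u → ⟦ usable z U F* u ⟧ * L u) (λ u → ⟦ usable z′ U F u ⟧ * L u)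
      agree u u≢r u≢b rewrite lookup∘tabulate (shift F) u
                            | update₂-agree (lookup F) r (fr ∨ fb) b (fr ∧ fb) u u≢r u≢b
                            | z′≈z u u≢r u≢b = refl
      local : ⟦ usable z U F* r ⟧ * L r + ⟦ usable z U F* b ⟧ * L b
            ≤ ⟦ usable z′ U F r ⟧ * L r + ⟦ usable z′ U F b ⟧ * L b
      local rewrite lookup∘tabulate (shift F) r | lookup∘tabulate (shift F) b
                  | update₂-at-r (lookup F) r (fr ∨ fb) b (fr ∧ fb) r≢b
                  | update₂-at-b (lookup F) r (fr ∨ fb) b (fr ∧ fb)
                  | zr | zb | z′r | z′b
        = exchange-capacity-≤ (N′ U r) (N′ U b) fr fb L-r≤L-b
            (N′-transfer conn U (∈⇒T v∈Γ) r∈N r∉B (from T-≡ b∈B) (≡⇒== cb) r≢b)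

    covers′ : ∀ U F → ∣ F ∣ ≡ α → ∣ U ∣ ≤ capacity z′ U F
    covers′ U F ∣F∣≡α = ≤-trans (covers U (tabulate (shift F)) (trans (∣shift∣ F) ∣F∣≡α)) (capacity-shift-≤ U F)

    invariant′ : Invariant z′
    invariant′ = record { size = size′ ; covers = covers′ ; reserve = reserve′ }

  exchange-step : ∀ {z m} → Invariant z → count (missing z) ≡ suc m →
                  ∃[ z′ ] Invariant z′ × count (missing z′) ≡ m
  exchange-step {z} I missing≡1+m
    with b , b-missing ← count-pos (missing z) (subst (0 <_) (sym missing≡1+m) (s≤s z≤n))
    with r , r-spare   ← count-pos (spare z (c b)) (≤-trans (s≤s z≤n) (Invariant.reserve I (c b) (c∈Γ b)))
    with b∉z , b∈B     ← to (T-∧ {not (z b)}) b-missing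
    with r∈z , r-rest  ← to (T-∧ {z r}) r-spare
    with r∉B , r∈N     ← to (T-∧ {not (inB r)}) r-rest
    = E.z′ , E.invariant′ , suc-injective (trans E.missing′ missing≡1+m)
    where
    module E = Exchange I (c∈Γ b) r∈N (to T-not-≡ r∉B) (to T-≡ r∈z) (to T-≡ b∈B) refl (to T-not-≡ b∉z)

  invariant⇒LP : ∀ {z} → Invariant z → LPFeasible G L k α Γ c B
  invariant⇒LP I = by-missing _ refl I
    where
    by-missing : ∀ m {z} → count (missing z) ≡ m → Invariant z → LPFeasible G L k α Γ c B
    by-missing zero    missing≡0   I = invariant+B-open⇒LP I missing≡0
    by-missing (suc m) missing≡1+m I with z′ , I′ , missing′≡m ← exchange-step I missing≡1+m
      = by-missing m missing′≡m I′

  module Integral {y : Fin n → ℕ} (y≤1 : ∀ u → y u ≤ 1) (∑y≡k : ∑ℕ y ≡ k)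
    (ilp : ∀ U F → ∣ F ∣ ≡ α →
           ∣ U ∣ ≤ ∑ℕ (λ u → if lookup (NG G U) u ∧ not (lookup F u) then y u * L u else 0))
    (α<k : α < k) where

    z₀ : Fin n → Bool
    z₀ u = y u ≡ᵇ 1

    y≡⟦z₀⟧ : ∀ u → y u ≡ ⟦ z₀ u ⟧
    y≡⟦z₀⟧ u = sym (⟦≡ᵇ1⟧ (y u) (y≤1 u))

    ilp-term : ∀ X F u → (if lookup X u ∧ not (lookup F u) then y u * L u else 0)
                         ≡ ⟦ z₀ u ∧ (lookup X u ∧ not (lookup F u)) ⟧ * L u
    ilp-term X F u = trans (cong (λ m → if lookup X u ∧ not (lookup F u) then m * L u else 0) (y≡⟦z₀⟧ u))
                           (if-⟦⟧ (lookup X u ∧ not (lookup F u)) (z₀ u) (L u))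

    size₀ : count z₀ ≡ k
    size₀ = trans (sym (∑-cong y≡⟦z₀⟧)) ∑y≡k

    covers₀ : ∀ U F → ∣ F ∣ ≡ α → ∣ U ∣ ≤ capacity z₀ U F
    covers₀ U F ∣F∣≡α = ≤-trans (ilp U F ∣F∣≡α) (∑-mono-≤ λ u →
      ≤-trans (≤-reflexive (ilp-term (NG G U) F u)) (*-monoˡ-≤ (L u) (⟦⟧-mono (NG-usable z₀ U F u))))

    α≤n : α ≤ n
    α≤n = ≤-trans (<⇒≤ α<k) (subst (_≤ n) size₀ (count≤n z₀))

    blocker : Fin n → Fin n → Bool
    blocker v u = spare z₀ v u ∨ kept z₀ v u

    N[]∩z₀⊆blocker : ∀ {v} u → v ∈ Γ → T (N[ v ] u) → T (z₀ u) → T (blocker v u)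
    N[]∩z₀⊆blocker {v} u v∈Γ u∈N z₀u = by-membership (inB u) refl
      where
      by-membership : ∀ x → inB u ≡ x → T (blocker v u)
      by-membership false u∉B = from (T-∨ {spare z₀ v u}) (inj₁
        (from (T-∧ {z₀ u}) (z₀u , from (T-∧ {not (inB u)}) (from T-not-≡ u∉B , u∈N))))
      by-membership true  u∈B = from (T-∨ {spare z₀ v u}) (inj₂
        (from (T-∧ {z₀ u}) (z₀u , from (T-∧ {inB u}) (from T-≡ u∈B , ≡⇒== (N[]⊆C v∈Γ u∈N)))))

    count-blocker≤α : ∀ {v} → v ∈ Γ → count (spare z₀ v) ≤ count (deficit z₀ v) → count (blocker v) ≤ α
    count-blocker≤α {v} v∈Γ spare≤deficit = begin
      count (blocker v)                              ≤⟨ ∑-mono-≤ (λ u → ⟦∨⟧≤ (spare z₀ v u) (kept z₀ v u)) ⟩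
      ∑ℕ (λ u → ⟦ spare z₀ v u ⟧ + ⟦ kept z₀ v u ⟧)  ≡⟨ ∑-distrib-+ (⟦_⟧ ∘ spare z₀ v) (⟦_⟧ ∘ kept z₀ v) ⟩
      count (spare z₀ v) + count (kept z₀ v)         ≤⟨ +-monoˡ-≤ (count (kept z₀ v)) spare≤deficit ⟩
      count (deficit z₀ v) + count (kept z₀ v)       ≡⟨ +-comm (count (deficit z₀ v)) _ ⟩
      count (kept z₀ v) + count (deficit z₀ v)       ≡⟨ kept+deficit z₀ v∈Γ ⟩
      α                                              ∎
      where open ≤-Reasoning

    ILP-forbids-blocking : ∀ {v} → v ∈ Γ → ∀ F → (∀ u → T (blocker v u) → T (F u)) → count F ≢ α
    ILP-forbids-blocking {v} v∈Γ F blocker⊆F countF≡α = n≮0 (begin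
      1                                                                           ≡⟨ sym ∣⁅v⁆∣≡1 ⟩
      ∣ ⁅v⁆ ∣                                                                     ≤⟨ ilp ⁅v⁆ (tabulate F) ∣F∣≡α ⟩
      ∑ℕ (λ u → if N[ v ] u ∧ not (lookup (tabulate F) u) then y u * L u else 0) ≡⟨ ∑-cong vanish ⟩
      ∑ℕ {n} (λ _ → 0)                                                            ≡⟨ ∑-zero {n} ⟩
      0                                                                           ∎)
      where
      open ≤-Reasoning
      ⁅v⁆ : Subset n
      ⁅v⁆ = tabulate (_== v)
      ∣⁅v⁆∣≡1 : ∣ ⁅v⁆ ∣ ≡ 1
      ∣⁅v⁆∣≡1 = trans (∣tabulate∣≡count (_== v)) (count-== v)
      ∣F∣≡α : ∣ tabulate F ∣ ≡ α
      ∣F∣≡α = trans (∣tabulate∣≡count F) countF≡α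
      unusable : ∀ u → ¬ T (z₀ u ∧ (N[ v ] u ∧ not (lookup (tabulate F) u)))
      unusable u t with z₀u , rest ← to (T-∧ {z₀ u}) t
                   with u∈N , u∉F  ← to (T-∧ {N[ v ] u}) rest
        = T-not⇒¬T (subst (T ∘ not) (lookup∘tabulate F u) u∉F) (blocker⊆F u (N[]∩z₀⊆blocker u v∈Γ u∈N z₀u))
      vanish : ∀ u → (if N[ v ] u ∧ not (lookup (tabulate F) u) then y u * L u else 0) ≡ 0
      vanish u = trans (ilp-term (NG G ⁅v⁆) (tabulate F) u) (cong (_* L u) (⟦⟧-false (unusable u)))

    reserve₀ : ∀ v → v ∈ Γ → count (deficit z₀ v) < count (spare z₀ v)
    reserve₀ v v∈Γ = ≰⇒> λ spare≤deficit →
      let (F , blocker⊆F , countF≡α) = extend-to-count (blocker v) α (count-blocker≤α v∈Γ spare≤deficit) α≤n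
      in  ILP-forbids-blocking v∈Γ F blocker⊆F countF≡α

    invariant₀ : Invariant z₀
    invariant₀ = record { size = size₀ ; covers = covers₀ ; reserve = reserve₀ }

  ILP⇒invariant : α < k → ILPFeasible G L k α → ∃[ z ] Invariant z
  ILP⇒invariant α<k (_ , y≤1 , ∑y≡k , ilp) = _ , Integral.invariant₀ y≤1 ∑y≡k ilp α<k

lemma5 : ∀ {n} (G : Graph n) → Connected G →
         (L : Fin n → ℕ) (k α : ℕ) → α < k →
         (Γ : Subset n) (c : Fin n → Fin n) (B : Subset n) →
         RootedTree3 G Γ →
         ClusterPartition G Γ c →
         TopCapacity L α Γ c B →
         ILPFeasible G L k α →
         LPFeasible G L k α Γ c B
lemma5 G conn L k α α<k Γ c B _ CP TC ilp = invariant⇒LP (proj₂ (ILP⇒invariant α<k ilp))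
  where open FromILP G conn L k α Γ c B CP TC
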